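{- Let $P$ be the infinite upper triangular Pascal matrix over $\mathbb{F}_2$, $P_{i,j}=\binom{j-1}{i-1}\bmod 2$ ($i,j\ge1$; zero for $j<i$), let $I$ be the infinite identity matrix, and let $L$ be any non-singular lower-triangular infinite matrix over $\mathbb{F}_2$. Let $w\ge0$ be an integer and $m=2^w$. Consider the two-dimensional digital sequence in base 2 with generating matrices $(C_1,C_2)=(L,P)$ or $(C_1,C_2)=(I,LP)$, and let $Q_{2^m}$ be the set of its first $2^m$ points. Then \[ q_\infty(Q_{2^m})\le\frac{1}{2^m}. \] Consequently, the corresponding digital $(0,2)$-sequence in base 2 is not well-separated.
   Context: Digital sequence in base 2: for an integer $n\ge0$ with binary expansion $n=n_0+2n_1+\cdots$, set $\vec n=(n_0,n_1,\ldots)^\top\in\mathbb{F}_2^\infty$, $\vec x_{n,j}=(x_{n,j,1},x_{n,j,2},\ldots)^\top=C_j\vec n$ over $\mathbb{F}_2$, $x_{n,j}=\sum_{k\ge1}x_{n,j,k}2^{ -k}$, and $\boldsymbol{x}_n=(x_{n,1},x_{n,2})$; the sequence is $(\boldsymbol{x}_n)_{n\ge0}$. $q_\infty(Q)=\min_{\boldsymbol{x}\ne\boldsymbol{y}\in Q}\|\boldsymbol{x}-\boldsymbol{y}\|_\infty/2$. A sequence is called well-separated here if the sequence of point sets $(Q_{2^m})_m$ (each a $(0,m,2)$-net in base 2) is well-separated, i.e. each $Q_{2^m}$ is $\kappa_m$-separated in base 2 with $\kappa_m\le m/2+C$ for a constant $C$, where $Q$ is $\kappa$-separated if there is $\boldsymbol{c}$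 with $0\le c_j\le\kappa$ such that every box $\prod_j\left[\frac{a_j-e_j/2}{2^{c_j}},\frac{a_j+(2-e_j)/2}{2^{c_j}}\right)\subseteq[0,1)^2$ (integers $0\le a_j\le2^{c_j}$, $e_j\in\{0,1\}$) contains at most one point of $Q$. -}

module Defs where

open import Data.Bool using (Bool; true; false; _xor_; _∧_)
open import Data.Nat using (ℕ; zero; suc; _+_; _*_; _^_; _≤_; _<_; _%_; _/_; _≡ᵇ_; ∣_-_∣)
open import Data.Nat.Combinatorics using (_C_)
open import Data.Product using (Σ; _×_; ∃)
open import Relation.Binary.PropositionalEquality using (_≡_)
open import Relation.Nullary using (¬_)

-- Infinite matrices over F₂ = Bool (xor = +, ∧ = *), indexed 0-based:
-- M i j is the entry in row i+1, column j+1 of the paper.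

Mat : Set
Mat = ℕ → ℕ → Bool

xorSum : ℕ → (ℕ → Bool) → Bool
xorSum zero    f = false
xorSum (suc n) f = xorSum n f xor f n

-- Pascal matrix: P_{i,j} = binom(j-1, i-1) mod 2 (1-based), i.e. binom(j,i) mod 2 0-based;
-- binom is 0 for i > j, so P is upper triangular.
Pascal : Mat
Pascal i j = ((j C i) % 2) ≡ᵇ 1

Identity : Mat
Identity i j = i ≡ᵇ j

NonsingLowerTriangular : Mat → Set
NonsingLowerTriangular L = (∀ i j → i < j → L i j ≡ false) × (∀ i → L i i ≡ true)

-- product L·M for a lower-triangular left factor L: (LM)_{ij} = Σ_{k ≤ i} L_{ik} M_{kj}
-- (the sum over all k is finite since L_{ik} = 0 for k > i).
mulLT : Mat → Mat → Mat
mulLT L M i j = xorSum (suc i) (λ k → L i k ∧ M k j)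

bit : ℕ → ℕ → Bool
bit n zero    = (n % 2) ≡ᵇ 1
bit n (suc l) = bit (n / 2) l

-- digit x_{n,j,k+1} of the point coordinate generated by matrix C:
-- row k of C times the digit vector of n.  (n_l = 0 for l ≥ n since n < 2^n.)
digit : Mat → ℕ → ℕ → Bool
digit G n k = xorSum n (λ l → G k l ∧ bit n l)

-- Real numbers in [0,1] given by binary digit streams  x = Σ_{k≥0} s k · 2^{-(k+1)}.
-- Truncation: T s K = 2^K · (Σ_{k<K} s k 2^{-(k+1)}), an integer, with
--   x^(K) := T s K / 2^K  ≤  x  ≤  x^(K) + 2^{-K}.

Stream : Set
Stream = ℕ → Bool

b2n : Bool → ℕ
b2n true  = 1
b2n false = 0

T : Stream → ℕ → ℕ
T s zero    = 0
T s (suc K) = 2 * T s K + b2n (s K)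

-- the real numbers denoted by s and t are equal  (⇔ ∀K, |x^(K) - y^(K)| ≤ 2^{-K})
RealEq : Stream → Stream → Set
RealEq s t = ∀ K → ∣ T s K - T t K ∣ ≤ 1

-- |x - y| ≤ 2 / 2^m   (⇔ ∀K, |x^(K) - y^(K)| ≤ 2/2^m + 2^{-K})
DistLe2/2^ : Stream → Stream → ℕ → Set
DistLe2/2^ s t m = ∀ K → ∣ T s K - T t K ∣ * 2 ^ m ≤ 2 * 2 ^ K + 2 ^ m

-- b / 2^d ≤ x   (⇔ ∀K, b/2^d ≤ x^(K) + 2^{-K})
GeqDyadic : Stream → ℕ → ℕ → Set
GeqDyadic s b d = ∀ K → b * 2 ^ K ≤ (T s K + 1) * 2 ^ d

-- x < b / 2^d   (⇔ ∃K, x^(K) + 2^{-K} < b/2^d)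
LtDyadic : Stream → ℕ → ℕ → Set
LtDyadic s b d = ∃ λ K → (T s K + 1) * 2 ^ d < b * 2 ^ K

coord : Mat → ℕ → Stream
coord G n = digit G n

PointEq : Mat → Mat → ℕ → ℕ → Set
PointEq C₁ C₂ n n' = RealEq (coord C₁ n) (coord C₁ n') × RealEq (coord C₂ n) (coord C₂ n')

-- q_∞(Q_N) ≤ 1/2^m  where Q_N = {x_0,...,x_{N-1}}:
-- some two distinct points x ≠ y of Q_N have ‖x - y‖_∞ / 2 ≤ 1/2^m.
-- (q_∞ is a minimum over finitely many pairs.)
QInfLe : Mat → Mat → ℕ → ℕ → Set
QInfLe C₁ C₂ N m =
  Σ ℕ λ n → Σ ℕ λ n' → n < N × n' < N × ¬ PointEq C₁ C₂ n n'
    × DistLe2/2^ (coord C₁ n) (coord C₁ n') m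
    × DistLe2/2^ (coord C₂ n) (coord C₂ n') m

-- x lies in the interval [ (a - e/2)/2^c , (a + (2-e)/2)/2^c ) = [ b/2^{c+1}, (b+2)/2^{c+1} )
-- with b = 2a - e.  Such an interval lies in [0,1) iff 0 ≤ b and b + 2 ≤ 2^{c+1}, and b = 2a - e
-- ranges over all such integers b (a ≤ 2^c, e ∈ {0,1}).
InInterval : Stream → ℕ → ℕ → Set
InInterval s c b = GeqDyadic s b (suc c) × LtDyadic s (b + 2) (suc c)

-- Q_N is κ-separated in base 2: there is c = (c₁,c₂), c_j ≤ κ, such that every box of the
-- above form contained in [0,1)² contains at most one point of Q_N.
Separated : Mat → Mat → ℕ → ℕ → Set
Separated C₁ C₂ N κ =
  Σ ℕ λ c₁ → Σ ℕ λ c₂ → c₁ ≤ κ × c₂ ≤ κ ×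
    (∀ b₁ b₂ → b₁ + 2 ≤ 2 ^ suc c₁ → b₂ + 2 ≤ 2 ^ suc c₂ →
      ∀ n n' → n < N → n' < N →
      InInterval (coord C₁ n) c₁ b₁ → InInterval (coord C₂ n) c₂ b₂ →
      InInterval (coord C₁ n') c₁ b₁ → InInterval (coord C₂ n') c₂ b₂ →
      PointEq C₁ C₂ n n')

-- the sequence is well-separated: (Q_{2^m})_m is well-separated, i.e. there are κ_m and a
-- constant C with Q_{2^m} κ_m-separated and κ_m ≤ m/2 + C for all m.
WellSeparated : Mat → Mat → Set
WellSeparated C₁ C₂ =
  Σ ℕ λ Cst → Σ (ℕ → ℕ) λ κ → ∀ m → Separated C₁ C₂ (2 ^ m) (κ m) × 2 * κ m ≤ m + 2 * Cst

{-# OPTIONS --safe #-}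
-- Write j = 2^w − 1.  Row j of Pascal's triangle mod 2 is all ones and row 2^w vanishes away
-- from its ends (Lucas).  Hence the points 1 and 1 + 2^j of the (L, P)-sequence (1 and 0 if w = 0),
-- and 1 and 2^(j+1) − 2 of the (I, LP)-sequence, agree in the first j digits of one coordinate,
-- while the other coordinates are ½ and ½ − 2^-(j+1): they are distinct and 2^-j apart.
-- Similarly 2^(j+1) and 3·2^j, resp. 1 + 2^(j+1) and 2^(j+2) − 2, are distinct points of
-- Q_{2^(j+2)} with one coordinate in [0, 2^-j) and the other ½ ± 2^-(j+2), so they share a box
-- of sides 2^-c₁ × 2^-c₂ whenever c₁, c₂ < j.  For m = j + 2 and j large, a bound
-- κ_m ≤ m/2 + C forces c₁, c₂ < j, so no such bound exists.
module Submission where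

open import Defs
open import Algebra.Bundles using (CommutativeRing; CommutativeMonoid)
open import Data.Bool using (Bool; true; false; not; _xor_; _∧_)
open import Data.Bool.Properties
  using ( xor-assoc; xor-comm; xor-same; xor-identityʳ; not-involutive; not-distribˡ-xor
        ; ∧-zeroʳ; ∧-identityʳ; ∧-assoc; ∧-distribˡ-xor; ∧-distribʳ-xor; T-≡
        ; xor-∧-commutativeRing )
open import Algebra.Properties.CommutativeSemigroup
  (CommutativeMonoid.commutativeSemigroup (CommutativeRing.+-commutativeMonoid xor-∧-commutativeRing))
  using (interchange)
open import Data.Nat
  using ( ℕ; zero; suc; _+_; _*_; _^_; _∸_; _≤_; _<_; _%_; _/_; _≡ᵇ_; _<ᵇ_; ∣_-_∣
        ; z≤n; s≤s; s≤s⁻¹; z<s )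
open import Data.Nat.Properties
open import Data.Nat.DivMod using (m*n%n≡0; [m+kn]%n≡m%n; m*n/n≡m; +-distrib-/; m<n*o⇒m/o<n)
open import Data.Nat.Combinatorics using (_C_; nCk+nC[k+1]≡[n+1]C[k+1])
open import Data.Nat.Tactic.RingSolver using (solve-∀)
open import Data.Product using (Σ; ∃; _×_; _,_; proj₁; proj₂)
open import Data.Sum using (_⊎_; inj₁; inj₂; [_,_]′)
open import Function.Bundles using (Equivalence)
open import Relation.Binary.PropositionalEquality
open import Relation.Nullary using (¬_)

-- Sums over F₂

xorSum-cong : ∀ n {f g : ℕ → Bool} → (∀ l → l < n → f l ≡ g l) → xorSum n f ≡ xorSum n g
xorSum-cong zero    _   = refl
xorSum-cong (suc n) f≗g =
  cong₂ _xor_ (xorSum-cong n (λ l l<n → f≗g l (m<n⇒m<1+n l<n))) (f≗g n (n<1+n n))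

xorSum-false : ∀ n {f : ℕ → Bool} → (∀ l → l < n → f l ≡ false) → xorSum n f ≡ false
xorSum-false zero    _   = refl
xorSum-false (suc n) f≗0 =
  cong₂ _xor_ (xorSum-false n (λ l l<n → f≗0 l (m<n⇒m<1+n l<n))) (f≗0 n (n<1+n n))

xorSum-stable : ∀ {a} n {f : ℕ → Bool} → (∀ l → a ≤ l → f l ≡ false) → a ≤ n →
                xorSum n f ≡ xorSum a f
xorSum-stable zero    _   z≤n = refl
xorSum-stable (suc n) f≗0 a≤1+n with m≤n⇒m<n∨m≡n a≤1+n
... | inj₂ refl  = refl
... | inj₁ a<1+n = trans (cong₂ _xor_ (xorSum-stable n f≗0 (s≤s⁻¹ a<1+n)) (f≗0 n (s≤s⁻¹ a<1+n)))
                         (xor-identityʳ _)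

xorSum-suc : ∀ n (f : ℕ → Bool) → xorSum (suc n) f ≡ f 0 xor xorSum n (λ l → f (suc l))
xorSum-suc zero    f = sym (xor-identityʳ (f 0))
xorSum-suc (suc n) f = trans (cong (_xor f (suc n)) (xorSum-suc n f)) (xor-assoc (f 0) _ _)

xorSum-xor : ∀ n (f g : ℕ → Bool) → xorSum n (λ l → f l xor g l) ≡ xorSum n f xor xorSum n g
xorSum-xor zero    f g = refl
xorSum-xor (suc n) f g =
  trans (cong (_xor (f n xor g n)) (xorSum-xor n f g)) (interchange (xorSum n f) (xorSum n g) (f n) (g n))

xorSum-∧ˡ : ∀ n c (f : ℕ → Bool) → xorSum n (λ l → c ∧ f l) ≡ c ∧ xorSum n f
xorSum-∧ˡ zero    c f = sym (∧-zeroʳ c)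
xorSum-∧ˡ (suc n) c f =
  trans (cong (_xor (c ∧ f n)) (xorSum-∧ˡ n c f)) (sym (∧-distribˡ-xor c (xorSum n f) (f n)))

xorSum-∧ʳ : ∀ n c (f : ℕ → Bool) → xorSum n (λ l → f l ∧ c) ≡ xorSum n f ∧ c
xorSum-∧ʳ zero    c f = refl
xorSum-∧ʳ (suc n) c f =
  trans (cong (_xor (f n ∧ c)) (xorSum-∧ʳ n c f)) (sym (∧-distribʳ-xor c (xorSum n f) (f n)))

xorSum-swap : ∀ a b (f : ℕ → ℕ → Bool) →
              xorSum a (λ i → xorSum b (f i)) ≡ xorSum b (λ j → xorSum a (λ i → f i j))
xorSum-swap zero    b f = sym (xorSum-false b (λ _ _ → refl))
xorSum-swap (suc a) b f =
  trans (cong (_xor xorSum b (f a)) (xorSum-swap a b f)) (sym (xorSum-xor b _ (f a)))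

xorSum-≡ᵇ : ∀ k n → xorSum n (λ l → k ≡ᵇ l) ≡ (k <ᵇ n)
xorSum-≡ᵇ k zero    = refl
xorSum-≡ᵇ k (suc n) = trans (cong (_xor (k ≡ᵇ n)) (xorSum-≡ᵇ k n)) (<ᵇ-suc k n)
  where
  <ᵇ-suc : ∀ k n → (k <ᵇ n) xor (k ≡ᵇ n) ≡ (k <ᵇ suc n)
  <ᵇ-suc zero    zero    = refl
  <ᵇ-suc zero    (suc n) = refl
  <ᵇ-suc (suc k) zero    = refl
  <ᵇ-suc (suc k) (suc n) = <ᵇ-suc k n

<⇒<ᵇ≡true : ∀ {k n} → k < n → (k <ᵇ n) ≡ true
<⇒<ᵇ≡true k<n = Equivalence.to T-≡ (<⇒<ᵇ k<n)

<ᵇ-irrefl : ∀ n → (n <ᵇ n) ≡ false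
<ᵇ-irrefl zero    = refl
<ᵇ-irrefl (suc n) = <ᵇ-irrefl n

<⇒≡ᵇ≡false : ∀ {k n} → k < n → (k ≡ᵇ n) ≡ false
<⇒≡ᵇ≡false {zero}  {suc n} _         = refl
<⇒≡ᵇ≡false {suc k} {suc n} (s≤s k<n) = <⇒≡ᵇ≡false k<n

≡ᵇ-refl : ∀ n → (n ≡ᵇ n) ≡ true
≡ᵇ-refl n = Equivalence.to T-≡ (≡⇒≡ᵇ n n refl)

xor-cancel : ∀ a b → a xor (b xor a) ≡ b
xor-cancel false b     = xor-identityʳ b
xor-cancel true  false = refl
xor-cancel true  true  = refl

ones : ℕ → ℕ
ones zero    = zero
ones (suc w) = 1 + 2 * ones w

suc-ones : ∀ w → suc (ones w) ≡ 2 ^ w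
suc-ones zero    = refl
suc-ones (suc w) = trans (sym (*-suc 2 (ones w))) (cong (2 *_) (suc-ones w))

n<2^n : ∀ n → n < 2 ^ n
n<2^n zero    = z<s
n<2^n (suc n) = ≤-<-trans (n<2^n n) (m<m+n (2 ^ n) (≤-trans (m^n>0 2 n) (m≤m+n _ 0)))

ones[n]<2^n : ∀ n → ones n < 2 ^ n
ones[n]<2^n n = ≤-reflexive (suc-ones n)

n≤ones[n] : ∀ n → n ≤ ones n
n≤ones[n] n = s≤s⁻¹ (subst (n <_) (sym (suc-ones n)) (n<2^n n))

2≤2^[1+n] : ∀ n → 2 ≤ 2 ^ suc n
2≤2^[1+n] n = ^-monoʳ-≤ 2 {1} {suc n} (s≤s z≤n)

1+2*n<2^[1+n] : ∀ n → 1 + 2 * n < 2 ^ suc n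
1+2*n<2^[1+n] n = begin-strict
  1 + 2 * n  <⟨ n<1+n _ ⟩
  2 + 2 * n  ≡⟨ *-suc 2 n ⟨
  2 * suc n  ≤⟨ *-monoʳ-≤ 2 (n<2^n n) ⟩
  2 ^ suc n  ∎
  where open ≤-Reasoning

1+2^[1+n]<2^[2+n] : ∀ n → 1 + 2 ^ suc n < 2 ^ (2 + n)
1+2^[1+n]<2^[2+n] n = begin-strict
  1 + 2 ^ suc n            ≡⟨ +-comm 1 _ ⟩
  2 ^ suc n + 1            <⟨ +-monoʳ-< (2 ^ suc n) (2≤2^[1+n] n) ⟩
  2 ^ suc n + 2 ^ suc n    ≡⟨ cong (2 ^ suc n +_) (+-identityʳ _) ⟨
  2 ^ (2 + n)              ∎
  where open ≤-Reasoning

2^n*3<2^[2+n] : ∀ n → 2 ^ n * 3 < 2 ^ (2 + n)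
2^n*3<2^[2+n] n = subst (2 ^ n * 3 <_) (four (2 ^ n)) (*-monoʳ-< (2 ^ n) {{m^n≢0 2 n}} ≤-refl)
  where
  four : ∀ x → x * 4 ≡ 2 * (2 * x)
  four = solve-∀

ones[n]+2≤2^[1+n] : ∀ n → ones n + 2 ≤ 2 ^ suc n
ones[n]+2≤2^[1+n] n = begin
  ones n + 2           ≡⟨ +-comm (ones n) 2 ⟩
  2 + ones n           ≤⟨ +-monoʳ-≤ 2 (m≤m+n (ones n) (ones n + 0)) ⟩
  suc (ones (suc n))   ≡⟨ suc-ones (suc n) ⟩
  2 ^ suc n            ∎
  where open ≤-Reasoning

bit-small : ∀ l {n} → n < 2 ^ l → bit n l ≡ false
bit-small zero    {zero}  _            = refl
bit-small zero    {suc n} (s≤s ())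
bit-small (suc l) {n}     n<2^[1+l] =
  bit-small l (m<n*o⇒m/o<n (subst (n <_) (*-comm 2 (2 ^ l)) n<2^[1+l]))

bit-beyond : ∀ {n a l} → n < 2 ^ a → a ≤ l → bit n l ≡ false
bit-beyond {l = l} n<2^a a≤l = bit-small l (<-≤-trans n<2^a (^-monoʳ-≤ 2 a≤l))

bit0-2* : ∀ x → bit (2 * x) 0 ≡ false
bit0-2* x = cong (_≡ᵇ 1) (trans (cong (_% 2) (*-comm 2 x)) (m*n%n≡0 x 2))

bit-suc-2* : ∀ x l → bit (2 * x) (suc l) ≡ bit x l
bit-suc-2* x l = cong (λ y → bit y l) (trans (cong (_/ 2) (*-comm 2 x)) (m*n/n≡m x 2))

bit0-1+2* : ∀ x → bit (1 + 2 * x) 0 ≡ true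
bit0-1+2* x = cong (_≡ᵇ 1) (trans (cong (λ y → (1 + y) % 2) (*-comm 2 x)) ([m+kn]%n≡m%n 1 x 2))

bit-suc-1+2* : ∀ x l → bit (1 + 2 * x) (suc l) ≡ bit x l
bit-suc-1+2* x l = cong (λ y → bit y l) (begin
  (1 + 2 * x) / 2      ≡⟨ cong (λ y → (1 + y) / 2) (*-comm 2 x) ⟩
  (1 + x * 2) / 2      ≡⟨ +-distrib-/ 1 (x * 2) (subst (λ r → 1 + r < 2) (sym (m*n%n≡0 x 2)) ≤-refl) ⟩
  1 / 2 + x * 2 / 2    ≡⟨ m*n/n≡m x 2 ⟩
  x                    ∎)
  where open ≡-Reasoning

bit0-suc : ∀ x → bit (suc x) 0 ≡ not (bit x 0)
bit0-suc zero    = refl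
bit0-suc (suc x) = begin
  bit (2 + x) 0          ≡⟨ cong (_≡ᵇ 1) (trans (cong (_% 2) (+-comm 2 x)) ([m+kn]%n≡m%n x 1 2)) ⟩
  bit x 0                ≡⟨ not-involutive (bit x 0) ⟨
  not (not (bit x 0))    ≡⟨ cong not (bit0-suc x) ⟨
  not (bit (suc x) 0)    ∎
  where open ≡-Reasoning

bit0-+ : ∀ a b → bit (a + b) 0 ≡ bit a 0 xor bit b 0
bit0-+ zero    b = refl
bit0-+ (suc a) b = begin
  bit (suc (a + b)) 0             ≡⟨ bit0-suc (a + b) ⟩
  not (bit (a + b) 0)             ≡⟨ cong not (bit0-+ a b) ⟩
  not (bit a 0 xor bit b 0)       ≡⟨ not-distribˡ-xor (bit a 0) (bit b 0) ⟩
  not (bit a 0) xor bit b 0       ≡⟨ cong (_xor bit b 0) (bit0-suc a) ⟨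
  bit (suc a) 0 xor bit b 0       ∎
  where open ≡-Reasoning

digit-bounded : ∀ G {n a} k → n < 2 ^ a → digit G n k ≡ xorSum a (λ l → G k l ∧ bit n l)
digit-bounded G {n} {a} k n<2^a =
  [ (λ a≤n → xorSum-stable n (vanish n<2^a) a≤n)
  , (λ n≤a → sym (xorSum-stable a (vanish (n<2^n n)) n≤a)) ]′ (≤-total a n)
  where
  vanish : ∀ {b} → n < 2 ^ b → ∀ l → b ≤ l → (G k l ∧ bit n l) ≡ false
  vanish n<2^b l b≤l = trans (cong (G k l ∧_) (bit-beyond n<2^b b≤l)) (∧-zeroʳ (G k l))

digit-1 : ∀ G k → digit G 1 k ≡ G k 0
digit-1 G k = ∧-identityʳ (G k 0)

digit-2* : ∀ G x k → digit G (2 * x) k ≡ digit (λ k l → G k (suc l)) x k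
digit-2* G x k = begin
  digit G (2 * x) k
    ≡⟨ digit-bounded G {a = suc x} k (<-trans (n<1+n (2 * x)) (1+2*n<2^[1+n] x)) ⟩
  xorSum (suc x) (λ l → G k l ∧ bit (2 * x) l)
    ≡⟨ xorSum-suc x _ ⟩
  (G k 0 ∧ bit (2 * x) 0) xor xorSum x (λ l → G k (suc l) ∧ bit (2 * x) (suc l))
    ≡⟨ cong₂ _xor_ (trans (cong (G k 0 ∧_) (bit0-2* x)) (∧-zeroʳ (G k 0)))
                   (xorSum-cong x (λ l _ → cong (G k (suc l) ∧_) (bit-suc-2* x l))) ⟩
  false xor xorSum x (λ l → G k (suc l) ∧ bit x l)
    ∎
  where open ≡-Reasoning

digit-1+2* : ∀ G x k → digit G (1 + 2 * x) k ≡ G k 0 xor digit (λ k l → G k (suc l)) x k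
digit-1+2* G x k = begin
  digit G (1 + 2 * x) k
    ≡⟨ digit-bounded G {a = suc x} k (1+2*n<2^[1+n] x) ⟩
  xorSum (suc x) (λ l → G k l ∧ bit (1 + 2 * x) l)
    ≡⟨ xorSum-suc x _ ⟩
  (G k 0 ∧ bit (1 + 2 * x) 0) xor xorSum x (λ l → G k (suc l) ∧ bit (1 + 2 * x) (suc l))
    ≡⟨ cong₂ _xor_ (trans (cong (G k 0 ∧_) (bit0-1+2* x)) (∧-identityʳ (G k 0)))
                   (xorSum-cong x (λ l _ → cong (G k (suc l) ∧_) (bit-suc-1+2* x l))) ⟩
  G k 0 xor xorSum x (λ l → G k (suc l) ∧ bit x l)
    ∎
  where open ≡-Reasoning

digit-2^ : ∀ G i k → digit G (2 ^ i) k ≡ G k i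
digit-2^ G zero    k = digit-1 G k
digit-2^ G (suc i) k = trans (digit-2* G (2 ^ i) k) (digit-2^ (λ k l → G k (suc l)) i k)

digit-1+2^ : ∀ G i k → digit G (1 + 2 ^ suc i) k ≡ G k 0 xor G k (suc i)
digit-1+2^ G i k =
  trans (digit-1+2* G (2 ^ i) k) (cong (G k 0 xor_) (digit-2^ (λ k l → G k (suc l)) i k))

digit-2^*3 : ∀ G i k → digit G (2 ^ i * 3) k ≡ G k i xor G k (suc i)
digit-2^*3 G zero    k =
  trans (digit-1+2* G 1 k) (cong (G k 0 xor_) (digit-1 (λ k l → G k (suc l)) k))
digit-2^*3 G (suc i) k =
  trans (cong (λ n → digit G n k) (*-assoc 2 (2 ^ i) 3))
        (trans (digit-2* G (2 ^ i * 3) k) (digit-2^*3 (λ k l → G k (suc l)) i k))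

digit-ones : ∀ G i k → digit G (ones i) k ≡ xorSum i (G k)
digit-ones G zero    k = refl
digit-ones G (suc i) k =
  trans (digit-1+2* G (ones i) k)
        (trans (cong (G k 0 xor_) (digit-ones (λ k l → G k (suc l)) i k)) (sym (xorSum-suc i (G k))))

digit-2*ones : ∀ G i k → digit G (2 * ones i) k ≡ xorSum i (λ l → G k (suc l))
digit-2*ones G i k = trans (digit-2* G (ones i) k) (digit-ones (λ k l → G k (suc l)) i k)

digit-mulLT : ∀ L M n k → digit (mulLT L M) n k ≡ xorSum (suc k) (λ k' → L k k' ∧ digit M n k')
digit-mulLT L M n k = begin
  xorSum n (λ l → xorSum (suc k) (λ k' → L k k' ∧ M k' l) ∧ bit n l)
    ≡⟨ xorSum-cong n (λ l _ → sym (xorSum-∧ʳ (suc k) (bit n l) _)) ⟩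
  xorSum n (λ l → xorSum (suc k) (λ k' → (L k k' ∧ M k' l) ∧ bit n l))
    ≡⟨ xorSum-swap n (suc k) _ ⟩
  xorSum (suc k) (λ k' → xorSum n (λ l → (L k k' ∧ M k' l) ∧ bit n l))
    ≡⟨ xorSum-cong (suc k) (λ k' _ →
         trans (xorSum-cong n (λ l _ → ∧-assoc (L k k') (M k' l) (bit n l)))
               (xorSum-∧ˡ n (L k k') (λ l → M k' l ∧ bit n l))) ⟩
  xorSum (suc k) (λ k' → L k k' ∧ digit M n k')
    ∎
  where open ≡-Reasoning

digit-mulLT-agree : ∀ L M {n n' d} → (∀ k → k < d → digit M n k ≡ digit M n' k) →
                    ∀ k → k < d → digit (mulLT L M) n k ≡ digit (mulLT L M) n' k
digit-mulLT-agree L M {n} {n'} agree k k<d =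
  trans (digit-mulLT L M n k)
        (trans (xorSum-cong (suc k) (λ k' k'≤k →
                  cong (L k k' ∧_) (agree k' (≤-<-trans (s≤s⁻¹ k'≤k) k<d))))
               (sym (digit-mulLT L M n' k)))

-- Binomial coefficients modulo 2

binom₂ : ℕ → ℕ → Bool
binom₂ _       zero    = true
binom₂ zero    (suc k) = false
binom₂ (suc n) (suc k) = binom₂ n k xor binom₂ n (suc k)

Pascal₂ : Mat
Pascal₂ i j = binom₂ j i

Pascal-binom₂ : ∀ n k → Pascal k n ≡ binom₂ n k
Pascal-binom₂ n       zero    = refl
Pascal-binom₂ zero    (suc k) = refl
Pascal-binom₂ (suc n) (suc k) = begin
  bit (suc n C suc k) 0                ≡⟨ cong (λ x → bit x 0) (nCk+nC[k+1]≡[n+1]C[k+1] n k) ⟨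
  bit (n C k + n C suc k) 0            ≡⟨ bit0-+ (n C k) (n C suc k) ⟩
  Pascal k n xor Pascal (suc k) n      ≡⟨ cong₂ _xor_ (Pascal-binom₂ n k) (Pascal-binom₂ n (suc k)) ⟩
  binom₂ (suc n) (suc k)               ∎
  where open ≡-Reasoning

digit-Pascal : ∀ n k → digit Pascal n k ≡ digit Pascal₂ n k
digit-Pascal n k = xorSum-cong n (λ l _ → cong (_∧ bit n l) (Pascal-binom₂ l k))

binom₂-above : ∀ {n k} → n < k → binom₂ n k ≡ false
binom₂-above {zero}  {suc k} _         = refl
binom₂-above {suc n} {suc k} (s≤s n<k) =
  cong₂ _xor_ (binom₂-above n<k) (binom₂-above (m<n⇒m<1+n n<k))

binom₂-diag : ∀ n → binom₂ n n ≡ true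
binom₂-diag zero    = refl
binom₂-diag (suc n) = cong₂ _xor_ (binom₂-diag n) (binom₂-above (n<1+n n))

-- Lucas' theorem for the last binary digit.
mutual
  binom₂-even-even : ∀ n k → binom₂ (2 * n) (2 * k) ≡ binom₂ n k
  binom₂-even-even zero    zero    = refl
  binom₂-even-even zero    (suc k) = refl
  binom₂-even-even (suc n) zero    = refl
  binom₂-even-even (suc n) (suc k) = begin
    binom₂ (2 * suc n) (2 * suc k)
      ≡⟨ cong₂ binom₂ (*-suc 2 n) (*-suc 2 k) ⟩
    binom₂ (1 + 2 * n) (1 + 2 * k) xor binom₂ (1 + 2 * n) (2 + 2 * k)
      ≡⟨ cong₂ _xor_ (binom₂-odd-odd n k)
                     (trans (cong (binom₂ (1 + 2 * n)) (sym (*-suc 2 k))) (binom₂-odd-even n (suc k))) ⟩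
    binom₂ n k xor binom₂ n (suc k)
      ∎
    where open ≡-Reasoning

  binom₂-even-odd : ∀ n k → binom₂ (2 * n) (1 + 2 * k) ≡ false
  binom₂-even-odd zero    k = refl
  binom₂-even-odd (suc n) k = begin
    binom₂ (2 * suc n) (1 + 2 * k)
      ≡⟨ cong (λ m → binom₂ m (1 + 2 * k)) (*-suc 2 n) ⟩
    binom₂ (1 + 2 * n) (2 * k) xor binom₂ (1 + 2 * n) (1 + 2 * k)
      ≡⟨ cong₂ _xor_ (binom₂-odd-even n k) (binom₂-odd-odd n k) ⟩
    binom₂ n k xor binom₂ n k
      ≡⟨ xor-same (binom₂ n k) ⟩
    false
      ∎
    where open ≡-Reasoning

  binom₂-odd-even : ∀ n k → binom₂ (1 + 2 * n) (2 * k) ≡ binom₂ n k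
  binom₂-odd-even n zero    = refl
  binom₂-odd-even n (suc k) = begin
    binom₂ (1 + 2 * n) (2 * suc k)
      ≡⟨ cong (binom₂ (1 + 2 * n)) (*-suc 2 k) ⟩
    binom₂ (2 * n) (1 + 2 * k) xor binom₂ (2 * n) (2 + 2 * k)
      ≡⟨ cong₂ _xor_ (binom₂-even-odd n k)
                     (trans (cong (binom₂ (2 * n)) (sym (*-suc 2 k))) (binom₂-even-even n (suc k))) ⟩
    binom₂ n (suc k)
      ∎
    where open ≡-Reasoning

  binom₂-odd-odd : ∀ n k → binom₂ (1 + 2 * n) (1 + 2 * k) ≡ binom₂ n k
  binom₂-odd-odd n k =
    trans (cong₂ _xor_ (binom₂-even-even n k) (binom₂-even-odd n k)) (xor-identityʳ (binom₂ n k))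

even-or-odd : ∀ k → ∃ λ c → k ≡ 2 * c ⊎ k ≡ 1 + 2 * c
even-or-odd zero    = 0 , inj₁ refl
even-or-odd (suc k) with even-or-odd k
... | c , inj₁ refl = c , inj₂ refl
... | c , inj₂ refl = suc c , inj₁ (sym (*-suc 2 c))

2*m≤1+2*n⇒m≤n : ∀ {m n} → 2 * m ≤ 1 + 2 * n → m ≤ n
2*m≤1+2*n⇒m≤n {m} {n} le =
  s≤s⁻¹ (*-cancelˡ-< 2 m (suc n) (≤-<-trans le (subst (1 + 2 * n <_) (sym (*-suc 2 n)) (n<1+n _))))

binom₂-ones : ∀ w {k} → k ≤ ones w → binom₂ (ones w) k ≡ true
binom₂-ones zero    z≤n = refl
binom₂-ones (suc w) {k} k≤ with even-or-odd k
... | c , inj₁ refl = trans (binom₂-odd-even (ones w) c) (binom₂-ones w {c} (2*m≤1+2*n⇒m≤n k≤))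
... | c , inj₂ refl =
  trans (binom₂-odd-odd (ones w) c) (binom₂-ones w {c} (2*m≤1+2*n⇒m≤n (≤-trans (n≤1+n _) k≤)))

binom₂-suc-ones : ∀ w {k} → k < ones w → binom₂ (suc (ones w)) (suc k) ≡ false
binom₂-suc-ones w k< = cong₂ _xor_ (binom₂-ones w (<⇒≤ k<)) (binom₂-ones w k<)

binom₂-suc-ones-low : ∀ w {k} → k < ones w → binom₂ (suc (ones w)) k ≡ binom₂ 0 k
binom₂-suc-ones-low w {zero}  _  = refl
binom₂-suc-ones-low w {suc k} k< = binom₂-suc-ones w (<-trans (n<1+n k) k<)

hockey-stick : ∀ j k → xorSum j (λ l → binom₂ (suc l) k) ≡ binom₂ 0 k xor binom₂ (suc j) (suc k)
hockey-stick zero    zero    = refl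
hockey-stick zero    (suc k) = refl
hockey-stick (suc j) k = begin
  xorSum j (λ l → binom₂ (suc l) k) xor binom₂ (suc j) k
    ≡⟨ cong (_xor binom₂ (suc j) k) (hockey-stick j k) ⟩
  (binom₂ 0 k xor binom₂ (suc j) (suc k)) xor binom₂ (suc j) k
    ≡⟨ xor-assoc (binom₂ 0 k) _ _ ⟩
  binom₂ 0 k xor (binom₂ (suc j) (suc k) xor binom₂ (suc j) k)
    ≡⟨ cong (binom₂ 0 k xor_) (xor-comm (binom₂ (suc j) (suc k)) _) ⟩
  binom₂ 0 k xor binom₂ (2 + j) (suc k)
    ∎
  where open ≡-Reasoning

-- Truncated binary expansions of reals

b2n≤1 : ∀ b → b2n b ≤ 1
b2n≤1 true  = ≤-refl
b2n≤1 false = z≤n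

offset-cases : (P : ℕ → ℕ → Set) → (∀ i b → P (i + b) b) → (∀ i a → P a (i + a)) →
               ∀ a b → P a b
offset-cases P below above a b with ≤-total b a
... | inj₁ b≤a = subst (λ x → P x b) (m∸n+n≡m b≤a) (below (a ∸ b) b)
... | inj₂ a≤b = subst (P a) (m∸n+n≡m a≤b) (above (b ∸ a) a)

∣-∣< : ∀ {x y e} → x < y + e → y < x + e → ∣ x - y ∣ < e
∣-∣< {x} {y} {e} x<y+e y<x+e with ≤-total x y
... | inj₁ x≤y = begin-strict
  ∣ x - y ∣   ≡⟨ m≤n⇒∣m-n∣≡n∸m x≤y ⟩
  y ∸ x       <⟨ ∸-monoˡ-< y<x+e x≤y ⟩
  x + e ∸ x   ≡⟨ m+n∸m≡n x e ⟩
  e           ∎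
  where open ≤-Reasoning
... | inj₂ y≤x = begin-strict
  ∣ x - y ∣   ≡⟨ m≤n⇒∣n-m∣≡n∸m y≤x ⟩
  x ∸ y       <⟨ ∸-monoˡ-< x<y+e y≤x ⟩
  y + e ∸ y   ≡⟨ m+n∸m≡n y e ⟩
  e           ∎
  where open ≤-Reasoning

T-cong : ∀ {s t : Stream} K → (∀ k → k < K → s k ≡ t k) → T s K ≡ T t K
T-cong zero    _   = refl
T-cong (suc K) s≗t =
  cong₂ (λ x b → 2 * x + b2n b) (T-cong K (λ k k<K → s≗t k (m<n⇒m<1+n k<K))) (s≗t K (n<1+n K))

T-zeros : ∀ {u : Stream} K → (∀ k → k < K → u k ≡ false) → T u K ≡ 0
T-zeros zero    _   = refl
T-zeros (suc K) u≗0 =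
  cong₂ (λ x b → 2 * x + b2n b) (T-zeros K (λ k k<K → u≗0 k (m<n⇒m<1+n k<K))) (u≗0 K (n<1+n K))

x*[2*y]≡2*[x*y] : ∀ x y → x * (2 * y) ≡ 2 * (x * y)
x*[2*y]≡2*[x*y] = solve-∀

T-lower : ∀ (u : Stream) K i → T u K * 2 ^ i ≤ T u (i + K)
T-lower u K zero    = ≤-reflexive (*-identityʳ (T u K))
T-lower u K (suc i) = begin
  T u K * (2 * 2 ^ i)     ≡⟨ x*[2*y]≡2*[x*y] (T u K) (2 ^ i) ⟩
  2 * (T u K * 2 ^ i)     ≤⟨ *-monoʳ-≤ 2 (T-lower u K i) ⟩
  2 * T u (i + K)         ≤⟨ m≤m+n _ _ ⟩
  T u (suc i + K)         ∎
  where open ≤-Reasoning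

T-upper : ∀ (u : Stream) K i → T u (i + K) < suc (T u K) * 2 ^ i
T-upper u K zero    = ≤-reflexive (sym (*-identityʳ (suc (T u K))))
T-upper u K (suc i) = begin-strict
  2 * T u (i + K) + b2n (u (i + K))   ≤⟨ +-monoʳ-≤ _ (b2n≤1 (u (i + K))) ⟩
  2 * T u (i + K) + 1                 <⟨ n<1+n _ ⟩
  suc (2 * T u (i + K) + 1)           ≡⟨ double (T u (i + K)) ⟩
  2 * suc (T u (i + K))               ≤⟨ *-monoʳ-≤ 2 (T-upper u K i) ⟩
  2 * (suc (T u K) * 2 ^ i)           ≡⟨ x*[2*y]≡2*[x*y] (suc (T u K)) (2 ^ i) ⟨
  suc (T u K) * 2 ^ suc i             ∎
  where
  open ≤-Reasoning
  double : ∀ x → suc (2 * x + 1) ≡ 2 * suc x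
  double = solve-∀

geqDyadic-T : ∀ (u : Stream) d → GeqDyadic u (T u d) d
geqDyadic-T u d K = offset-cases (λ d K → T u d * 2 ^ K ≤ (T u K + 1) * 2 ^ d) coarser finer d K
  where
  open ≤-Reasoning
  rearrange : ∀ a x y → suc a * x * y ≡ (a + 1) * (x * y)
  rearrange = solve-∀
  coarser : ∀ i K → T u (i + K) * 2 ^ K ≤ (T u K + 1) * 2 ^ (i + K)
  coarser i K = begin
    T u (i + K) * 2 ^ K             ≤⟨ *-monoˡ-≤ (2 ^ K) (<⇒≤ (T-upper u K i)) ⟩
    suc (T u K) * 2 ^ i * 2 ^ K     ≡⟨ rearrange (T u K) (2 ^ i) (2 ^ K) ⟩
    (T u K + 1) * (2 ^ i * 2 ^ K)   ≡⟨ cong ((T u K + 1) *_) (^-distribˡ-+-* 2 i K) ⟨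
    (T u K + 1) * 2 ^ (i + K)       ∎
  finer : ∀ i d → T u d * 2 ^ (i + d) ≤ (T u (i + d) + 1) * 2 ^ d
  finer i d = begin
    T u d * 2 ^ (i + d)             ≡⟨ cong (T u d *_) (^-distribˡ-+-* 2 i d) ⟩
    T u d * (2 ^ i * 2 ^ d)         ≡⟨ *-assoc (T u d) (2 ^ i) (2 ^ d) ⟨
    T u d * 2 ^ i * 2 ^ d           ≤⟨ *-monoˡ-≤ (2 ^ d) (T-lower u d i) ⟩
    T u (i + d) * 2 ^ d             ≤⟨ *-monoˡ-≤ (2 ^ d) (m≤m+n (T u (i + d)) 1) ⟩
    (T u (i + d) + 1) * 2 ^ d       ∎

ltDyadic-T : ∀ (u : Stream) d → LtDyadic u (T u d + 2) d
ltDyadic-T u d = d , *-monoˡ-< (2 ^ d) {{m^n≢0 2 d}} (+-monoʳ-< (T u d) ≤-refl)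

ltDyadic-next : ∀ {u : Stream} {d} → u d ≡ false → LtDyadic u (T u d + 1) d
ltDyadic-next {u} {d} u≡0 = suc d , (begin-strict
  (T u (suc d) + 1) * 2 ^ d          ≡⟨ cong (λ b → (2 * T u d + b2n b + 1) * 2 ^ d) u≡0 ⟩
  (2 * T u d + 0 + 1) * 2 ^ d        <⟨ *-monoˡ-< (2 ^ d) {{m^n≢0 2 d}} (+-monoʳ-< (2 * T u d + 0) ≤-refl) ⟩
  (2 * T u d + 0 + 2) * 2 ^ d        ≡⟨ rearrange (T u d) (2 ^ d) ⟩
  (T u d + 1) * 2 ^ suc d            ∎)
  where
  open ≤-Reasoning
  rearrange : ∀ x w → (2 * x + 0 + 2) * w ≡ (x + 1) * (2 * w)
  rearrange = solve-∀

ltDyadic⇒ : ∀ {u : Stream} {b d} → LtDyadic u b d → ∀ K → T u K * 2 ^ d < b * 2 ^ K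
ltDyadic⇒ {u} {b} {d} (K₀ , x<b) K =
  offset-cases (λ K₀ K → (T u K₀ + 1) * 2 ^ d < b * 2 ^ K₀ → T u K * 2 ^ d < b * 2 ^ K)
               coarser finer K₀ K x<b
  where
  open ≤-Reasoning
  swap : ∀ a x y → a * x * y ≡ a * y * x
  swap = solve-∀
  coarser : ∀ i K → (T u (i + K) + 1) * 2 ^ d < b * 2 ^ (i + K) → T u K * 2 ^ d < b * 2 ^ K
  coarser i K x<b = *-cancelʳ-< (2 ^ i) _ _ (begin-strict
    T u K * 2 ^ d * 2 ^ i         ≡⟨ swap (T u K) (2 ^ d) (2 ^ i) ⟩
    T u K * 2 ^ i * 2 ^ d         ≤⟨ *-monoˡ-≤ (2 ^ d) (T-lower u K i) ⟩
    T u (i + K) * 2 ^ d           ≤⟨ *-monoˡ-≤ (2 ^ d) (m≤m+n (T u (i + K)) 1) ⟩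
    (T u (i + K) + 1) * 2 ^ d     <⟨ x<b ⟩
    b * 2 ^ (i + K)               ≡⟨ cong (b *_) (^-distribˡ-+-* 2 i K) ⟩
    b * (2 ^ i * 2 ^ K)           ≡⟨ *-assoc b (2 ^ i) (2 ^ K) ⟨
    b * 2 ^ i * 2 ^ K             ≡⟨ swap b (2 ^ i) (2 ^ K) ⟩
    b * 2 ^ K * 2 ^ i             ∎)
  finer : ∀ i K₀ → (T u K₀ + 1) * 2 ^ d < b * 2 ^ K₀ → T u (i + K₀) * 2 ^ d < b * 2 ^ (i + K₀)
  finer i K₀ x<b = begin-strict
    T u (i + K₀) * 2 ^ d            <⟨ *-monoˡ-< (2 ^ d) {{m^n≢0 2 d}} (T-upper u K₀ i) ⟩
    suc (T u K₀) * 2 ^ i * 2 ^ d    ≡⟨ rearrange (T u K₀) (2 ^ i) (2 ^ d) ⟩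
    (T u K₀ + 1) * 2 ^ d * 2 ^ i    ≤⟨ *-monoˡ-≤ (2 ^ i) (<⇒≤ x<b) ⟩
    b * 2 ^ K₀ * 2 ^ i              ≡⟨ swap b (2 ^ K₀) (2 ^ i) ⟩
    b * 2 ^ i * 2 ^ K₀              ≡⟨ *-assoc b (2 ^ i) (2 ^ K₀) ⟩
    b * (2 ^ i * 2 ^ K₀)            ≡⟨ cong (b *_) (^-distribˡ-+-* 2 i K₀) ⟨
    b * 2 ^ (i + K₀)                ∎
    where
    rearrange : ∀ a x y → suc a * x * y ≡ (a + 1) * y * x
    rearrange = solve-∀

inInterval-T : ∀ {u : Stream} {c b} → T u (suc c) ≡ b → InInterval u c b
inInterval-T {u} {c} refl = geqDyadic-T u (suc c) , ltDyadic-T u (suc c)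

inInterval-T-pred : ∀ {u : Stream} {c b} → u (suc c) ≡ false → T u (suc c) ≡ suc b →
                    InInterval u c b
inInterval-T-pred {u} {c} {b} u≡0 T≡1+b =
  (λ K → ≤-trans (*-monoˡ-≤ (2 ^ K) (n≤1+n b))
                 (subst (λ x → GeqDyadic u x (suc c)) T≡1+b (geqDyadic-T u (suc c)) K)) ,
  subst (λ x → LtDyadic u x (suc c)) (trans (cong (_+ 1) T≡1+b) (sym (+-suc b 1))) (ltDyadic-next u≡0)

inInterval-zero : ∀ {u : Stream} {c d} → (∀ k → k < d → u k ≡ false) → c < d → InInterval u c 0
inInterval-zero u≗0 c<d = inInterval-T (T-zeros _ (λ k k≤c → u≗0 k (<-≤-trans k≤c c<d)))

inInterval-window : ∀ {s t : Stream} {c b} → InInterval s c b → InInterval t c b →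
  ∀ K → T t K * 2 ^ suc c < T s K * 2 ^ suc c + (2 * 2 ^ K + 2 ^ suc c)
inInterval-window {s} {t} {c} {b} (s≥b , _) (_ , t<b+2) K = begin-strict
  T t K * W                       <⟨ ltDyadic⇒ {b = b + 2} {suc c} t<b+2 K ⟩
  (b + 2) * 2 ^ K                 ≡⟨ *-distribʳ-+ (2 ^ K) b 2 ⟩
  b * 2 ^ K + 2 * 2 ^ K           ≤⟨ +-monoˡ-≤ (2 * 2 ^ K) (s≥b K) ⟩
  (T s K + 1) * W + 2 * 2 ^ K     ≡⟨ rearrange (T s K) W (2 * 2 ^ K) ⟩
  T s K * W + (2 * 2 ^ K + W)     ∎
  where
  open ≤-Reasoning
  W = 2 ^ suc c
  rearrange : ∀ x w y → (x + 1) * w + y ≡ x * w + (y + w)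
  rearrange = solve-∀

close-if-sameInterval : ∀ {s t : Stream} {c b} → InInterval s c b → InInterval t c b →
                        DistLe2/2^ s t (suc c)
close-if-sameInterval {s} {t} {c} {b} s∈ t∈ K = begin
  ∣ T s K - T t K ∣ * 2 ^ suc c                  ≡⟨ *-distribʳ-∣-∣ (2 ^ suc c) (T s K) (T t K) ⟩
  ∣ T s K * 2 ^ suc c - T t K * 2 ^ suc c ∣
    ≤⟨ <⇒≤ (∣-∣< (inInterval-window {c = c} {b} t∈ s∈ K)
                  (inInterval-window {c = c} {b} s∈ t∈ K)) ⟩
  2 * 2 ^ K + 2 ^ suc c                          ∎
  where open ≤-Reasoning

close-if-agree : ∀ {s t : Stream} {j} → (∀ k → k < j → s k ≡ t k) → DistLe2/2^ s t (suc j)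
close-if-agree {s} {t} {j} agree K =
  offset-cases (λ K j → (∀ k → k < j → s k ≡ t k) →
                        ∣ T s K - T t K ∣ * 2 ^ suc j ≤ 2 * 2 ^ K + 2 ^ suc j)
               far near K j agree
  where
  open ≤-Reasoning
  near : ∀ i K → (∀ k → k < i + K → s k ≡ t k) →
         ∣ T s K - T t K ∣ * 2 ^ suc (i + K) ≤ 2 * 2 ^ K + 2 ^ suc (i + K)
  near i K s≗t rewrite T-cong K (λ k k<K → s≗t k (<-≤-trans k<K (m≤n+m K i))) | ∣n-n∣≡0 (T t K) = z≤n
  far : ∀ i j → (∀ k → k < j → s k ≡ t k) →
        ∣ T s (i + j) - T t (i + j) ∣ * 2 ^ suc j ≤ 2 * 2 ^ (i + j) + 2 ^ suc j
  far i j s≗t = begin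
    ∣ T s (i + j) - T t (i + j) ∣ * 2 ^ suc j
      ≤⟨ *-monoˡ-≤ (2 ^ suc j)
                   (<⇒≤ (∣-∣< (window s t (T-cong j s≗t)) (window t s (sym (T-cong j s≗t))))) ⟩
    2 ^ i * 2 ^ suc j              ≡⟨ ^-distribˡ-+-* 2 i (suc j) ⟨
    2 ^ (i + suc j)                ≡⟨ cong (2 ^_) (+-suc i j) ⟩
    2 * 2 ^ (i + j)                ≤⟨ m≤m+n _ _ ⟩
    2 * 2 ^ (i + j) + 2 ^ suc j    ∎
    where
    window : ∀ (u v : Stream) → T u j ≡ T v j → T u (i + j) < T v (i + j) + 2 ^ i
    window u v T≡ = begin-strict
      T u (i + j)              <⟨ T-upper u j i ⟩
      suc (T u j) * 2 ^ i      ≡⟨ cong (λ x → suc x * 2 ^ i) T≡ ⟩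
      2 ^ i + T v j * 2 ^ i    ≤⟨ +-monoʳ-≤ (2 ^ i) (T-lower v j i) ⟩
      2 ^ i + T v (i + j)      ≡⟨ +-comm (2 ^ i) _ ⟩
      T v (i + j) + 2 ^ i      ∎

-- The first j + 1 digits of u are 10…0, resp. 01…1: u starts like ½, resp. ½ − 2^-(j+1).
record Leads10 (u : Stream) (j : ℕ) : Set where
  constructor leads10
  field
    head : u 0 ≡ true
    tail : ∀ k → k < j → u (suc k) ≡ false

record Leads01 (u : Stream) (j : ℕ) : Set where
  constructor leads01
  field
    head : u 0 ≡ false
    tail : ∀ k → k < j → u (suc k) ≡ true

leads10-≤ : ∀ {u c j} → c ≤ j → Leads10 u j → Leads10 u c
leads10-≤ c≤j (leads10 u₀ u₊) = leads10 u₀ (λ k k<c → u₊ k (<-≤-trans k<c c≤j))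

leads01-≤ : ∀ {u c j} → c ≤ j → Leads01 u j → Leads01 u c
leads01-≤ c≤j (leads01 u₀ u₊) = leads01 u₀ (λ k k<c → u₊ k (<-≤-trans k<c c≤j))

T-leads10 : ∀ {u} c → Leads10 u c → T u (suc c) ≡ 2 ^ c
T-leads10 zero    (leads10 u₀ _)     = cong b2n u₀
T-leads10 (suc c) l@(leads10 _ u₊) =
  trans (cong₂ (λ x b → 2 * x + b2n b) (T-leads10 c (leads10-≤ (n≤1+n c) l)) (u₊ c (n<1+n c)))
        (+-identityʳ (2 * 2 ^ c))

T-leads01 : ∀ {u} c → Leads01 u c → T u (suc c) ≡ ones c
T-leads01 zero    (leads01 u₀ _)     = cong b2n u₀
T-leads01 (suc c) l@(leads01 _ u₊) =
  trans (cong₂ (λ x b → 2 * x + b2n b) (T-leads01 c (leads01-≤ (n≤1+n c) l)) (u₊ c (n<1+n c)))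
        (+-comm (2 * ones c) 1)

inInterval-centre⁺ : ∀ {u c} → Leads10 u (suc c) → InInterval u c (ones c)
inInterval-centre⁺ {u} {c} l@(leads10 _ u₊) =
  inInterval-T-pred {u} {c} (u₊ c (n<1+n c))
    (trans (T-leads10 c (leads10-≤ (n≤1+n c) l)) (sym (suc-ones c)))

inInterval-centre⁻ : ∀ {u c} → Leads01 u c → InInterval u c (ones c)
inInterval-centre⁻ {u} {c} l = inInterval-T {u} {c} (T-leads01 c l)

¬RealEq-T : ∀ {s t : Stream} {K} → T s K ≡ suc (T t K) → s K ≡ t K → ¬ RealEq s t
¬RealEq-T {s} {t} {K} Ts≡1+Tt sK≡tK s≈t = 1+n≰n (subst (_≤ 1) gap (s≈t (suc K)))
  where
  open ≡-Reasoning
  y : ℕ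
  y = 2 * T t K + b2n (t K)
  shift : ∀ m b → 2 * suc m + b ≡ 2 * m + b + 2
  shift = solve-∀
  gap : ∣ T s (suc K) - T t (suc K) ∣ ≡ 2
  gap = begin
    ∣ 2 * T s K + b2n (s K) - y ∣          ≡⟨ cong₂ (λ m b → ∣ 2 * m + b2n b - y ∣) Ts≡1+Tt sK≡tK ⟩
    ∣ 2 * suc (T t K) + b2n (t K) - y ∣    ≡⟨ cong ∣_- y ∣ (shift (T t K) (b2n (t K))) ⟩
    ∣ y + 2 - y ∣                          ≡⟨ ∣-∣-comm (y + 2) y ⟩
    ∣ y - y + 2 ∣                          ≡⟨ ∣m-m+n∣≡n y 2 ⟩
    2                                      ∎

¬RealEq-leads : ∀ {s t j} → Leads10 s j → Leads01 t j → s (suc j) ≡ t (suc j) → ¬ RealEq s t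
¬RealEq-leads {j = j} s10 t01 =
  ¬RealEq-T (trans (T-leads10 j s10) (sym (trans (cong suc (T-leads01 j t01)) (suc-ones j))))

around-½ : ∀ {s t j} → Leads10 s (suc j) → Leads01 t j → t (suc j) ≡ false →
           DistLe2/2^ s t (suc j) × ¬ RealEq s t
around-½ {s} {t} {j} s10 t01 t₁ =
  close-if-sameInterval {s} {t} {j} {ones j} (inInterval-centre⁺ s10) (inInterval-centre⁻ t01) ,
  ¬RealEq-leads (leads10-≤ (n≤1+n j) s10) t01 (trans (Leads10.tail s10 j (n<1+n j)) (sym t₁))

straddle-½ : ∀ {s t j} → Leads10 s j → s (suc j) ≡ true → Leads01 t (suc j) →
  ¬ RealEq s t × (∀ {c} → c < j → InInterval s c (ones c) × InInterval t c (ones c))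
straddle-½ {j = j} s10 s₁ t01 =
  ¬RealEq-leads s10 (leads01-≤ (n≤1+n j) t01) (trans s₁ (sym (Leads01.tail t01 j (n<1+n j)))) ,
  λ c<j → inInterval-centre⁺ (leads10-≤ c<j s10) ,
          inInterval-centre⁻ (leads01-≤ (<⇒≤ (m<n⇒m<1+n c<j)) t01)

SeparatedAt : Mat → Mat → ℕ → ℕ → ℕ → Set
SeparatedAt C₁ C₂ N c₁ c₂ =
  ∀ b₁ b₂ → b₁ + 2 ≤ 2 ^ suc c₁ → b₂ + 2 ≤ 2 ^ suc c₂ →
  ∀ n n' → n < N → n' < N →
  InInterval (coord C₁ n) c₁ b₁ → InInterval (coord C₂ n) c₂ b₂ →
  InInterval (coord C₁ n') c₁ b₁ → InInterval (coord C₂ n') c₂ b₂ →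
  PointEq C₁ C₂ n n'

κ<d : ∀ {c κ d C} → c ≤ κ → 2 * κ ≤ 2 + d + 2 * C → 2 * (2 + C) ≤ d → c < d
κ<d {c} {κ} {d} {C} c≤κ κ-bound d-large = *-cancelˡ-≤ 2 (begin
  2 * suc c                ≤⟨ *-monoʳ-≤ 2 (s≤s c≤κ) ⟩
  2 * suc κ                ≡⟨ *-suc 2 κ ⟩
  2 + 2 * κ                ≤⟨ +-monoʳ-≤ 2 κ-bound ⟩
  2 + (2 + d + 2 * C)      ≡⟨ regroup d C ⟩
  d + 2 * (2 + C)          ≤⟨ +-monoʳ-≤ d d-large ⟩
  d + d                    ≡⟨ double d ⟩
  2 * d                    ∎)
  where
  open ≤-Reasoning
  regroup : ∀ d C → 2 + (2 + d + 2 * C) ≡ d + 2 * (2 + C)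
  regroup = solve-∀
  double : ∀ d → d + d ≡ 2 * d
  double = solve-∀

¬wellSeparated : ∀ {C₁ C₂} →
  (∀ D → Σ ℕ λ d → D ≤ d ×
           (∀ {c₁ c₂} → c₁ < d → c₂ < d → ¬ SeparatedAt C₁ C₂ (2 ^ (2 + d)) c₁ c₂)) →
  ¬ WellSeparated C₁ C₂
¬wellSeparated unseparated (C , κ , separated) =
  let d , D≤d , ¬sep = unseparated (2 * (2 + C))
      (c₁ , c₂ , c₁≤κ , c₂≤κ , sep) , κ-bound = separated (2 + d)
  in ¬sep (κ<d c₁≤κ κ-bound D≤d) (κ<d c₂≤κ κ-bound D≤d) sep

-- The two sequences

LowerTriangular : Mat → Set
LowerTriangular G = ∀ i j → i < j → G i j ≡ false

QInfLe-L-Pascal : ∀ {L} → LowerTriangular L → ∀ w → QInfLe L Pascal (2 ^ suc (ones w)) (suc (ones w))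
QInfLe-L-Pascal _ zero =
  1 , 0 , ≤-refl , z<s , (λ eq → proj₂ close (proj₂ eq)) , close-if-agree {j = 0} (λ _ ()) , proj₁ close
  where
  close : DistLe2/2^ (coord Pascal 1) (coord Pascal 0) 1 × ¬ RealEq (coord Pascal 1) (coord Pascal 0)
  close = around-½ {j = 0} (leads10 refl (λ _ _ → refl)) (leads01 refl (λ _ ())) refl
QInfLe-L-Pascal {L} lowerTri (suc v) =
  1 , n' , 2≤2^[1+n] j , 1+2^[1+n]<2^[2+n] i , (λ eq → proj₂ close (proj₂ eq)) ,
  close-if-agree agree , proj₁ close
  where
  i j n' : ℕ
  i = 2 * ones v
  j = suc i
  n' = 1 + 2 ^ j
  agree : ∀ k → k < j → digit L 1 k ≡ digit L n' k
  agree k k<j = begin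
    digit L 1 k                ≡⟨ digit-1 L k ⟩
    L k 0                      ≡⟨ xor-identityʳ (L k 0) ⟨
    L k 0 xor false            ≡⟨ cong (L k 0 xor_) (lowerTri k j k<j) ⟨
    L k 0 xor L k j            ≡⟨ digit-1+2^ L i k ⟨
    digit L n' k               ∎
    where open ≡-Reasoning
  P-n' : ∀ k → digit Pascal n' k ≡ binom₂ 0 k xor binom₂ j k
  P-n' k = trans (digit-Pascal n' k) (digit-1+2^ Pascal₂ i k)
  close : DistLe2/2^ (coord Pascal 1) (coord Pascal n') (suc j) ×
          ¬ RealEq (coord Pascal 1) (coord Pascal n')
  close = around-½ (leads10 refl (λ _ _ → refl))
                   (leads01 (P-n' 0) (λ k k<j → trans (P-n' (suc k)) (binom₂-ones (suc v) k<j)))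
                   (trans (P-n' (suc j)) (binom₂-above (n<1+n j)))

QInfLe-Identity-LP : ∀ L w → QInfLe Identity (mulLT L Pascal) (2 ^ suc (ones w)) (suc (ones w))
QInfLe-Identity-LP L w =
  1 , n' , 2≤2^[1+n] j , *-monoʳ-< 2 (ones[n]<2^n j) , (λ eq → proj₂ close (proj₁ eq)) ,
  proj₁ close , close-if-agree (digit-mulLT-agree L Pascal {1} {n'} agree)
  where
  j n' : ℕ
  j = ones w
  n' = 2 * ones j
  I-n' : ∀ k → digit Identity n' k ≡ xorSum j (λ l → k ≡ᵇ suc l)
  I-n' = digit-2*ones Identity j
  close : DistLe2/2^ (coord Identity 1) (coord Identity n') (suc j) ×
          ¬ RealEq (coord Identity 1) (coord Identity n')
  close = around-½ (leads10 refl (λ _ _ → refl))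
                   (leads01 (trans (I-n' 0) (xorSum-false j (λ _ _ → refl)))
                            (λ k k<j → trans (I-n' (suc k)) (trans (xorSum-≡ᵇ k j) (<⇒<ᵇ≡true k<j))))
                   (trans (I-n' (suc j)) (trans (xorSum-≡ᵇ j j) (<ᵇ-irrefl j)))
  agree : ∀ k → k < j → digit Pascal 1 k ≡ digit Pascal n' k
  agree k k<j = begin
    digit Pascal 1 k                            ≡⟨ digit-Pascal 1 k ⟩
    digit Pascal₂ 1 k                           ≡⟨ digit-1 Pascal₂ k ⟩
    binom₂ 0 k                                  ≡⟨ xor-identityʳ (binom₂ 0 k) ⟨
    binom₂ 0 k xor false                        ≡⟨ cong (binom₂ 0 k xor_) (binom₂-suc-ones w k<j) ⟨
    binom₂ 0 k xor binom₂ (suc j) (suc k)       ≡⟨ hockey-stick j k ⟨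
    xorSum j (λ l → binom₂ (suc l) k)           ≡⟨ digit-2*ones Pascal₂ j k ⟨
    digit Pascal₂ n' k                          ≡⟨ digit-Pascal n' k ⟨
    digit Pascal n' k                           ∎
    where open ≡-Reasoning

¬SeparatedAt-L-Pascal : ∀ {L} → LowerTriangular L → ∀ w {c₁ c₂} → c₁ < ones w → c₂ < ones w →
                        ¬ SeparatedAt L Pascal (2 ^ (2 + ones w)) c₁ c₂
¬SeparatedAt-L-Pascal {L} lowerTri w {c₁} {c₂} c₁<j c₂<j sep =
  proj₁ halves (proj₂ (sep 0 (ones c₂) (2≤2^[1+n] c₁) (ones[n]+2≤2^[1+n] c₂) n n'
                          (^-monoʳ-< 2 ≤-refl (n<1+n (suc j))) (2^n*3<2^[2+n] j)
                          (inInterval-zero L-n c₁<j) (proj₁ (proj₂ halves c₂<j))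
                          (inInterval-zero L-n' c₁<j) (proj₂ (proj₂ halves c₂<j))))
  where
  j n n' : ℕ
  j = ones w
  n = 2 ^ suc j
  n' = 2 ^ j * 3
  L-n : ∀ k → k < j → digit L n k ≡ false
  L-n k k<j = trans (digit-2^ L (suc j) k) (lowerTri k (suc j) (m<n⇒m<1+n k<j))
  L-n' : ∀ k → k < j → digit L n' k ≡ false
  L-n' k k<j = trans (digit-2^*3 L j k)
                     (cong₂ _xor_ (lowerTri k j k<j) (lowerTri k (suc j) (m<n⇒m<1+n k<j)))
  P-n : ∀ k → digit Pascal n k ≡ binom₂ (suc j) k
  P-n k = trans (digit-Pascal n k) (digit-2^ Pascal₂ (suc j) k)
  P-n' : ∀ k → digit Pascal n' k ≡ binom₂ j k xor binom₂ (suc j) k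
  P-n' k = trans (digit-Pascal n' k) (digit-2^*3 Pascal₂ j k)
  halves : ¬ RealEq (coord Pascal n) (coord Pascal n') ×
           (∀ {c} → c < j → InInterval (coord Pascal n) c (ones c) ×
                            InInterval (coord Pascal n') c (ones c))
  halves = straddle-½ (leads10 (P-n 0) (λ k k<j → trans (P-n (suc k)) (binom₂-suc-ones w k<j)))
                      (trans (P-n (suc j)) (binom₂-diag (suc j)))
                      (leads01 (P-n' 0) (λ k k≤j →
                         trans (P-n' (suc k))
                               (trans (xor-cancel (binom₂ j (suc k)) (binom₂ j k))
                                      (binom₂-ones w (s≤s⁻¹ k≤j)))))

¬SeparatedAt-Identity-LP : ∀ L w {c₁ c₂} → c₁ < ones w → c₂ < ones w →
                           ¬ SeparatedAt Identity (mulLT L Pascal) (2 ^ (2 + ones w)) c₁ c₂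
¬SeparatedAt-Identity-LP L w {c₁} {c₂} c₁<j c₂<j sep =
  proj₁ halves (proj₁ (sep (ones c₁) 0 (ones[n]+2≤2^[1+n] c₁) (2≤2^[1+n] c₂) n n'
                          (1+2^[1+n]<2^[2+n] j) (*-monoʳ-< 2 (ones[n]<2^n (suc j)))
                          (proj₁ (proj₂ halves c₁<j)) (inInterval-zero (LP-zero {n} P-n) c₂<j)
                          (proj₂ (proj₂ halves c₁<j)) (inInterval-zero (LP-zero {n'} P-n') c₂<j)))
  where
  j n n' : ℕ
  j = ones w
  n = 1 + 2 ^ suc j
  n' = 2 * ones (suc j)
  I-n : ∀ k → digit Identity n k ≡ (k ≡ᵇ 0) xor (k ≡ᵇ suc j)
  I-n = digit-1+2^ Identity j
  I-n' : ∀ k → digit Identity n' k ≡ xorSum (suc j) (λ l → k ≡ᵇ suc l)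
  I-n' = digit-2*ones Identity (suc j)
  P-n : ∀ k → k < j → digit Pascal n k ≡ false
  P-n k k<j = begin
    digit Pascal n k                        ≡⟨ trans (digit-Pascal n k) (digit-1+2^ Pascal₂ j k) ⟩
    binom₂ 0 k xor binom₂ (suc j) k         ≡⟨ cong (binom₂ 0 k xor_) (binom₂-suc-ones-low w k<j) ⟩
    binom₂ 0 k xor binom₂ 0 k               ≡⟨ xor-same (binom₂ 0 k) ⟩
    false                                   ∎
    where open ≡-Reasoning
  P-n' : ∀ k → k < j → digit Pascal n' k ≡ false
  P-n' k k<j = begin
    digit Pascal n' k
      ≡⟨ trans (digit-Pascal n' k) (trans (digit-2*ones Pascal₂ (suc j) k) (hockey-stick (suc j) k)) ⟩
    binom₂ 0 k xor (binom₂ (suc j) k xor binom₂ (suc j) (suc k))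
      ≡⟨ cong (binom₂ 0 k xor_) (cong₂ _xor_ (binom₂-suc-ones-low w k<j) (binom₂-suc-ones w k<j)) ⟩
    binom₂ 0 k xor (binom₂ 0 k xor false)
      ≡⟨ cong (binom₂ 0 k xor_) (xor-identityʳ (binom₂ 0 k)) ⟩
    binom₂ 0 k xor binom₂ 0 k
      ≡⟨ xor-same (binom₂ 0 k) ⟩
    false
      ∎
    where open ≡-Reasoning
  LP-zero : ∀ {m} → (∀ k → k < j → digit Pascal m k ≡ false) →
            ∀ k → k < j → digit (mulLT L Pascal) m k ≡ false
  LP-zero {m} P-zero = digit-mulLT-agree L Pascal {m} {0} P-zero
  halves : ¬ RealEq (coord Identity n) (coord Identity n') ×
           (∀ {c} → c < j → InInterval (coord Identity n) c (ones c) ×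
                            InInterval (coord Identity n') c (ones c))
  halves = straddle-½ (leads10 (I-n 0) (λ k k<j → trans (I-n (suc k)) (<⇒≡ᵇ≡false k<j)))
                      (trans (I-n (suc j)) (≡ᵇ-refl j))
                      (leads01 (trans (I-n' 0) (xorSum-false (suc j) (λ _ _ → refl)))
                               (λ k k≤j → trans (I-n' (suc k))
                                                (trans (xorSum-≡ᵇ k (suc j)) (<⇒<ᵇ≡true k≤j))))

mainTheorem8 : (L : Mat) → NonsingLowerTriangular L → (w : ℕ) →
    (QInfLe L Pascal (2 ^ (2 ^ w)) (2 ^ w) × QInfLe Identity (mulLT L Pascal) (2 ^ (2 ^ w)) (2 ^ w))
    × (¬ WellSeparated L Pascal × ¬ WellSeparated Identity (mulLT L Pascal))
mainTheorem8 L (lowerTri , _) w =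
  ( subst (λ m → QInfLe L Pascal (2 ^ m) m) (suc-ones w) (QInfLe-L-Pascal lowerTri w)
  , subst (λ m → QInfLe Identity (mulLT L Pascal) (2 ^ m) m) (suc-ones w) (QInfLe-Identity-LP L w) )
  , ( ¬wellSeparated (λ D → ones D , n≤ones[n] D , ¬SeparatedAt-L-Pascal lowerTri D)
    , ¬wellSeparated (λ D → ones D , n≤ones[n] D , ¬SeparatedAt-Identity-LP L D) )
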